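{- Let $\mathcal A$ be an S-ring over a finite cyclic group $G$. Suppose that an $\mathcal A$-group $H$ has an $\mathcal A$-complement and that $|S|=2$ for some $\mathcal A$-section $S$ projectively equivalent to $G/H$. Then for every $\mathcal A$-section $T$ projectively equivalent to $H/1$, the S-ring $\mathcal A$ is Cayley isomorphic to $\mathcal A_S\otimes\mathcal A_T$.
   Context: An S-ring over a finite group $G$ is a subring $\mathcal A$ of $\mathbb Z G$ spanned by the sums $\underline X=\sum_{x\in X}x$ over the blocks $X$ of a partition of $G$ (basic sets) containing $\{e\}$ and closed under $X\mapsto X^{ -1}$. An $\mathcal A$-group is a subgroup that is a union of basic sets; an $\mathcal A$-section is $U/L$ with $L\le U$ $\mathcal A$-groups, with restriction $\mathcal A_{U/L}$ the S-ring over $U/L$ whose basic sets are the images of basic sets contained in $U$. An $\mathcal A$-complement of an $\mathcal A$-group $H$ is an $\mathcal A$-group $H'$ with $G=H\times H'$. Projective equivalence of $\mathcal A$-sections is the equivalence relation generated by the relation $U_1/L_1\to U_2/L_2$ holding when $U_1\cap L_2=L_1$ and $U_1L_2=U_2$. For S-rings $\mathcal A_1$ over $G_1$ and $\mathcal A_2$ over $G_2$, $\mathcal A_1\otimes\mathcal A_2$ is the S-ring over $G_1\times G_2$ with basic sets $X_1\times X_2$. Cayley isomorphism: a group isomorphism mapping basic sets onto basic sets. -}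

module Defs where

open import Data.Nat using (ℕ; zero; suc; _+_; _*_; _∸_; _≡ᵇ_)
open import Data.Nat.DivMod using (_mod_)
open import Data.Fin using (Fin; toℕ)
open import Data.Bool using (Bool; true; false; if_then_else_; _∧_)
open import Data.List using (List; map; allFin)
open import Data.Nat.ListAction using (sum)
open import Data.Product using (Σ; _×_; _,_; proj₁; proj₂; ∃)
open import Relation.Binary.PropositionalEquality using (_≡_)
open import Relation.Binary.Construct.Closure.Equivalence using (EqClosure)

-- The finite cyclic group ℤ/(suc m) on the carrier Fin (suc m)
-- (every finite cyclic group is isomorphic to one of these).

Cyc : ℕ → Set
Cyc m = Fin (suc m)

e : ∀ {m} → Cyc m
e {m} = 0 mod (suc m)

_⊕_ : ∀ {m} → Cyc m → Cyc m → Cyc m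
_⊕_ {m} a b = (toℕ a + toℕ b) mod (suc m)

inv : ∀ {m} → Cyc m → Cyc m
inv {m} a = (suc m ∸ toℕ a) mod (suc m)

_⊖_ : ∀ {m} → Cyc m → Cyc m → Cyc m
a ⊖ b = a ⊕ inv b

count : ∀ {m} → (Cyc m → Bool) → ℕ
count {m} p = sum (map (λ x → if p x then 1 else 0) (allFin (suc m)))

-- S-rings over Cyc m.  The partition into basic sets is given by a
-- labelling  cls : Cyc m → ℕ  (basic sets = nonempty fibres of cls).

record SRing (m : ℕ) : Set where
  field
    cls : Cyc m → ℕ
    unit-basic : ∀ x → cls x ≡ cls e → x ≡ e
    inv-closed : ∀ x y → cls x ≡ cls y → cls (inv x) ≡ cls (inv y)
    -- the span of the sums of basic sets is closed under multiplication:
    -- the coefficient of z in  X̲ · Y̲  (X ∋ x₀, Y ∋ y₀) is constant on basic sets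
    ring-closed : ∀ x₀ y₀ z z' → cls z ≡ cls z' →
      count (λ x → (cls x ≡ᵇ cls x₀) ∧ (cls (z ⊖ x) ≡ᵇ cls y₀))
        ≡ count (λ x → (cls x ≡ᵇ cls x₀) ∧ (cls (z' ⊖ x) ≡ᵇ cls y₀))

open SRing public

Subset : ℕ → Set
Subset m = Cyc m → Bool

Full : ∀ {m} → Subset m
Full _ = true

Trivial : ∀ {m} → Subset m
Trivial {m} x = toℕ x ≡ᵇ 0

record IsAGroup {m} (A : SRing m) (H : Subset m) : Set where
  field
    has-e    : H e ≡ true
    ⊕-closed : ∀ x y → H x ≡ true → H y ≡ true → H (x ⊕ y) ≡ true
    inv-closedH : ∀ x → H x ≡ true → H (inv x) ≡ true
    union-of-basic : ∀ x y → cls A x ≡ cls A y → H x ≡ H y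

record Section {m} (A : SRing m) : Set where
  constructor sec
  field
    U L : Subset m
    U-grp : IsAGroup A U
    L-grp : IsAGroup A L
    L⊆U : ∀ x → L x ≡ true → U x ≡ true

open Section public

-- |U/L| = |U| / |L|; we state |U/L| = k as |U| = k * |L|
order≡ : ∀ {m} {A : SRing m} → Section A → ℕ → Set
order≡ S k = count (U S) ≡ k * count (L S)

-- the elementary relation U₁/L₁ → U₂/L₂ :  U₁ ∩ L₂ = L₁  and  U₁L₂ = U₂
_⟶_ : ∀ {m} {A : SRing m} → Section A → Section A → Set
_⟶_ {m} S₁ S₂ =
  (∀ x → (U S₁ x ∧ L S₂ x) ≡ L S₁ x) ×
  (∀ x → (U S₂ x ≡ true →
            Σ (Cyc m) λ u → Σ (Cyc m) λ l →
              U S₁ u ≡ true × L S₂ l ≡ true × x ≡ u ⊕ l)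
       × (∀ u l → U S₁ u ≡ true → L S₂ l ≡ true → U S₂ (u ⊕ l) ≡ true))

ProjEq : ∀ {m} {A : SRing m} → Section A → Section A → Set
ProjEq = EqClosure _⟶_

IsAComplement : ∀ {m} (A : SRing m) (H H' : Subset m) → Set
IsAComplement {m} A H H' =
  IsAGroup A H' ×
  (∀ x → H x ≡ true → H' x ≡ true → x ≡ e) ×
  (∀ g → Σ (Cyc m) λ h → Σ (Cyc m) λ h' →
           H h ≡ true × H' h' ≡ true × g ≡ h ⊕ h')

G/_ : ∀ {m} {A : SRing m} (H : Subset m) → IsAGroup A H → Section A
G/_ {m} {A} H hg = sec Full H
  (record { has-e = Relation.Binary.PropositionalEquality.refl
          ; ⊕-closed = λ _ _ _ _ → Relation.Binary.PropositionalEquality.refl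
          ; inv-closedH = λ _ _ → Relation.Binary.PropositionalEquality.refl
          ; union-of-basic = λ _ _ _ → Relation.Binary.PropositionalEquality.refl })
  hg (λ _ _ → Relation.Binary.PropositionalEquality.refl)

-- The restriction 𝒜_{U/L}.  Elements of U/L are represented by elements
-- u of U, two representatives being equal iff u ⊖ u' ∈ L.

_≈[_]_ : ∀ {m} {A : SRing m} → Cyc m → Section A → Cyc m → Set
u ≈[ S ] u' = L S (u ⊖ u') ≡ true

-- uL and u'L lie in the same basic set of 𝒜_{U/L}, i.e. in the image π(X)
-- of one basic set X ⊆ U of 𝒜
SameBasic : ∀ {m} {A : SRing m} → Section A → Cyc m → Cyc m → Set
SameBasic {m} {A} S u u' =
  Σ (Cyc m) λ l → Σ (Cyc m) λ l' →
    L S l ≡ true × L S l' ≡ true × cls A (u ⊕ l) ≡ cls A (u' ⊕ l')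

-- 𝒜 is Cayley isomorphic to 𝒜_S ⊗ 𝒜_T: there is a group isomorphism
-- f : G → (U_S/L_S) × (U_T/L_T) (given on representatives) mapping every
-- basic set of 𝒜 onto a basic set X₁ × X₂ of 𝒜_S ⊗ 𝒜_T.
record CayleyIsoTensor {m} (A : SRing m) (S T : Section A) : Set where
  field
    f : Cyc m → Cyc m × Cyc m
    f-in : ∀ g → U S (proj₁ (f g)) ≡ true × U T (proj₂ (f g)) ≡ true
    f-hom : ∀ g g' →
      proj₁ (f (g ⊕ g')) ≈[ S ] (proj₁ (f g) ⊕ proj₁ (f g')) ×
      proj₂ (f (g ⊕ g')) ≈[ T ] (proj₂ (f g) ⊕ proj₂ (f g'))
    f-inj : ∀ g g' → proj₁ (f g) ≈[ S ] proj₁ (f g') →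
                     proj₂ (f g) ≈[ T ] proj₂ (f g') → g ≡ g'
    f-surj : ∀ u v → U S u ≡ true → U T v ≡ true →
      Σ (Cyc m) λ g → proj₁ (f g) ≈[ S ] u × proj₂ (f g) ≈[ T ] v
    f-basic : ∀ g g' →
      (cls A g ≡ cls A g' →
         SameBasic S (proj₁ (f g)) (proj₁ (f g')) ×
         SameBasic T (proj₂ (f g)) (proj₂ (f g'))) ×
      (SameBasic S (proj₁ (f g)) (proj₁ (f g')) →
         SameBasic T (proj₂ (f g)) (proj₂ (f g')) →
         cls A g ≡ cls A g')

private
  open import Relation.Binary.PropositionalEquality using (refl; sym; trans; cong)
  open import Data.Nat.DivMod using (n%n≡0)
  open import Data.Fin using (zero; suc)
  open import Data.Fin.Properties using (fromℕ<-cong)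
  open import Data.Nat using (s≤s; z≤n)

  e≡zero : ∀ {m} → e {m} ≡ zero
  e≡zero = refl

  triv→ : ∀ {m} (x : Cyc m) → Trivial x ≡ true → x ≡ e
  triv→ zero _ = refl
  triv→ (suc x) ()

  triv← : ∀ {m} (x : Cyc m) → x ≡ e → Trivial x ≡ true
  triv← _ refl = refl

  inv-e : ∀ {m} → inv (e {m}) ≡ e
  inv-e {m} = fromℕ<-cong _ _ (n%n≡0 (suc m)) _ (s≤s z≤n)

IsAGroup-Trivial : ∀ {m} (A : SRing m) → IsAGroup A Trivial
IsAGroup-Trivial {m} A = record
  { has-e = refl
  ; ⊕-closed = λ x y px py → triv← _ (helper x y (triv→ x px) (triv→ y py))
  ; inv-closedH = λ x px → triv← _ (trans (cong inv (triv→ x px)) inv-e)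
  ; union-of-basic = λ x y c → lemma x y c
  }
  where
  helper : ∀ (x y : Cyc m) → x ≡ e → y ≡ e → x ⊕ y ≡ e
  helper _ _ refl refl = refl
  lemma : ∀ x y → cls A x ≡ cls A y → Trivial x ≡ Trivial y
  lemma zero zero c = refl
  lemma zero (suc y) c with unit-basic A (suc y) (sym c)
  ... | ()
  lemma (suc x) zero c with unit-basic A (suc x) c
  ... | ()
  lemma (suc x) (suc y) c = refl

Trivial⊆ : ∀ {m} {A : SRing m} {H : Subset m} → IsAGroup A H →
           ∀ x → Trivial x ≡ true → H x ≡ true
Trivial⊆ {H = H} Hg x p with triv→ x p
... | refl = IsAGroup.has-e Hg

_/1 : ∀ {m} {A : SRing m} (H : Subset m) → IsAGroup A H → Section A
_/1 {A = A} H Hg = sec H Trivial Hg (IsAGroup-Trivial A) (Trivial⊆ Hg)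

-- Projective equivalence gives isomorphisms 𝒜_S ≅ 𝒜_{G/H} and 𝒜_T ≅ 𝒜_{H/1}: for a
-- step U₁/L₁ → U₂/L₂ the map uL₁ ↦ uL₂ is a group isomorphism, and it matches basic
-- sets because, by ring-closedness, every z in the basic set of x ⊕ y is x' ⊕ y' with
-- x', y' in the basic sets of x, y. Since |S| = 2, H has index at most 2, so the
-- complement H' is {e} or {e, t} with t ⊕ t = e; being an 𝒜-group containing the basic
-- set {e}, H' is a union of singleton basic sets, and translation by a singleton basic
-- set permutes the basic sets. Writing g = h ⊕ h', the basic set of g is thus determined
-- by gH and the basic set of h, so g ↦ (gH, h) is a Cayley isomorphism
-- 𝒜 ≅ 𝒜_{G/H} ⊗ 𝒜_{H/1}.

module Submission where

open import Defs
open import Algebra.Bundles using (AbelianGroup)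
open import Algebra.Structures using (IsAbelianGroup)
open import Data.Bool using (Bool; true; false; _∧_; _∨_; if_then_else_)
open import Data.Bool.Properties using (_≟_; T-≡; ⇔→≡)
open import Data.Empty using (⊥; ⊥-elim)
open import Data.Fin using (Fin; toℕ; zero; suc)
open import Data.Fin.Permutation using (permutation)
open import Data.Fin.Properties using (toℕ-injective; toℕ-fromℕ<; toℕ<n; any?)
open import Data.List using (List; []; _∷_; map; allFin; tabulate)
import Data.Nat as ℕ
open import Data.Nat using (ℕ; suc; NonZero; >-nonZero; _+_; _*_; _∸_; _%_; _≤_; _≡ᵇ_; z≤n; s≤s)
open import Data.Nat.DivMod using (%-distribˡ-+; m%n%n≡m%n; m<n⇒m%n≡m; n%n≡0)
open import Data.Nat.ListAction using (sum)
open import Data.Nat.Properties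
  using ( +-comm; +-assoc; +-suc; +-identityʳ; m+[n∸m]≡n; <⇒≤; *-cancelʳ-≤; ≤-trans; m≤n+m
        ; ≡ᵇ⇒≡; ≡⇒≡ᵇ; +-0-commutativeMonoid; module ≤-Reasoning)
open import Data.Product using (Σ; _×_; _,_; proj₁; proj₂)
open import Data.Sum using (_⊎_; inj₁; inj₂)
open import Function using (id; _∘_; _⇔_; Equivalence; mk⇔)
open import Level using (0ℓ)
open import Relation.Binary.Construct.Closure.Equivalence using (fold)
open import Relation.Binary.PropositionalEquality
open import Relation.Binary.Structures using (IsEquivalence)
open import Relation.Nullary using (yes; no)
open import Relation.Nullary.Decidable using (_×-dec_)

open import Algebra.Properties.CommutativeMonoid.Sum +-0-commutativeMonoid
  using (sum-permute) renaming (sum to ∑)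

private
  ∧-intro : ∀ {a b} → a ≡ true → b ≡ true → a ∧ b ≡ true
  ∧-intro refl refl = refl

  ∧-elim : ∀ {a b} → a ∧ b ≡ true → a ≡ true × b ≡ true
  ∧-elim {true} {true} _ = refl , refl

  ∨-elim : ∀ {a b} → a ∨ b ≡ true → a ≡ true ⊎ b ≡ true
  ∨-elim {true}  _   = inj₁ refl
  ∨-elim {false} b≡t = inj₂ b≡t

module _ {m : ℕ} where
  private
    n : ℕ
    n = suc m

  toℕ-⊕ : (a b : Cyc m) → toℕ (a ⊕ b) ≡ (toℕ a + toℕ b) % n
  toℕ-⊕ a b = toℕ-fromℕ< _

  %-absorbˡ : ∀ x y → (x % n + y) % n ≡ (x + y) % n
  %-absorbˡ x y = begin
    (x % n + y) % n          ≡⟨ %-distribˡ-+ (x % n) y n ⟩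
    (x % n % n + y % n) % n  ≡⟨ cong (λ z → (z + y % n) % n) (m%n%n≡m%n x n) ⟩
    (x % n + y % n) % n      ≡⟨ %-distribˡ-+ x y n ⟨
    (x + y) % n              ∎
    where open ≡-Reasoning

  %-absorbʳ : ∀ x y → (x + y % n) % n ≡ (x + y) % n
  %-absorbʳ x y = begin
    (x + y % n) % n  ≡⟨ cong (_% n) (+-comm x (y % n)) ⟩
    (y % n + x) % n  ≡⟨ %-absorbˡ y x ⟩
    (y + x) % n      ≡⟨ cong (_% n) (+-comm y x) ⟩
    (x + y) % n      ∎
    where open ≡-Reasoning

  ⊕-comm : (a b : Cyc m) → a ⊕ b ≡ b ⊕ a
  ⊕-comm a b = toℕ-injective (begin
    toℕ (a ⊕ b)          ≡⟨ toℕ-⊕ a b ⟩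
    (toℕ a + toℕ b) % n  ≡⟨ cong (_% n) (+-comm (toℕ a) (toℕ b)) ⟩
    (toℕ b + toℕ a) % n  ≡⟨ toℕ-⊕ b a ⟨
    toℕ (b ⊕ a)          ∎)
    where open ≡-Reasoning

  ⊕-assoc : (a b c : Cyc m) → (a ⊕ b) ⊕ c ≡ a ⊕ (b ⊕ c)
  ⊕-assoc a b c = toℕ-injective (begin
    toℕ ((a ⊕ b) ⊕ c)                  ≡⟨ toℕ-⊕ (a ⊕ b) c ⟩
    (toℕ (a ⊕ b) + toℕ c) % n          ≡⟨ cong (λ z → (z + toℕ c) % n) (toℕ-⊕ a b) ⟩
    ((toℕ a + toℕ b) % n + toℕ c) % n  ≡⟨ %-absorbˡ (toℕ a + toℕ b) (toℕ c) ⟩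
    (toℕ a + toℕ b + toℕ c) % n        ≡⟨ cong (_% n) (+-assoc (toℕ a) (toℕ b) (toℕ c)) ⟩
    (toℕ a + (toℕ b + toℕ c)) % n      ≡⟨ %-absorbʳ (toℕ a) (toℕ b + toℕ c) ⟨
    (toℕ a + (toℕ b + toℕ c) % n) % n  ≡⟨ cong (λ z → (toℕ a + z) % n) (toℕ-⊕ b c) ⟨
    (toℕ a + toℕ (b ⊕ c)) % n          ≡⟨ toℕ-⊕ a (b ⊕ c) ⟨
    toℕ (a ⊕ (b ⊕ c))                  ∎)
    where open ≡-Reasoning

  ⊕-identityˡ : (a : Cyc m) → e ⊕ a ≡ a
  ⊕-identityˡ a = toℕ-injective (trans (toℕ-⊕ e a) (m<n⇒m%n≡m (toℕ<n a)))

  ⊕-inverseʳ : (a : Cyc m) → a ⊕ inv a ≡ e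
  ⊕-inverseʳ a = toℕ-injective (begin
    toℕ (a ⊕ inv a)                ≡⟨ toℕ-⊕ a (inv a) ⟩
    (toℕ a + toℕ (inv a)) % n      ≡⟨ cong (λ z → (toℕ a + z) % n) (toℕ-fromℕ< _) ⟩
    (toℕ a + (n ∸ toℕ a) % n) % n  ≡⟨ %-absorbʳ (toℕ a) (n ∸ toℕ a) ⟩
    (toℕ a + (n ∸ toℕ a)) % n      ≡⟨ cong (_% n) (m+[n∸m]≡n (<⇒≤ (toℕ<n a))) ⟩
    n % n                          ≡⟨ n%n≡0 n ⟩
    0                              ∎)
    where open ≡-Reasoning

  ⊕-isAbelianGroup : IsAbelianGroup _≡_ (_⊕_ {m}) e inv
  ⊕-isAbelianGroup = record
    { isGroup = record
      { isMonoid = record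
        { isSemigroup = record
          { isMagma = record { isEquivalence = isEquivalence ; ∙-cong = cong₂ _⊕_ }
          ; assoc = ⊕-assoc
          }
        ; identity = ⊕-identityˡ , λ a → trans (⊕-comm a e) (⊕-identityˡ a)
        }
      ; inverse = (λ a → trans (⊕-comm (inv a) a) (⊕-inverseʳ a)) , ⊕-inverseʳ
      ; ⁻¹-cong = cong inv
      }
    ; comm = ⊕-comm
    }

Cycᴳ : ℕ → AbelianGroup 0ℓ 0ℓ
Cycᴳ m = record { isAbelianGroup = ⊕-isAbelianGroup {m} }

module _ {m : ℕ} where
  open AbelianGroup (Cycᴳ m) using (commutativeSemigroup)
  open import Algebra.Properties.AbelianGroup (Cycᴳ m)
  open import Algebra.Properties.CommutativeSemigroup commutativeSemigroup
    using (interchange)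
  open ≡-Reasoning

  ⊕-cancelˡ : (x y z : Cyc m) → x ⊕ y ≡ x ⊕ z → y ≡ z
  ⊕-cancelˡ = ∙-cancelˡ

  ⊕-interchange : (a b c d : Cyc m) → (a ⊕ b) ⊕ (c ⊕ d) ≡ (a ⊕ c) ⊕ (b ⊕ d)
  ⊕-interchange = interchange

  inv[inv[x]]≡x : (x : Cyc m) → inv (inv x) ≡ x
  inv[inv[x]]≡x = ⁻¹-involutive

  x⊖y≡e⇒x≡y : (x y : Cyc m) → x ⊖ y ≡ e → x ≡ y
  x⊖y≡e⇒x≡y = x∙y⁻¹≈ε⇒x≈y

  x⊖x≡e : (x : Cyc m) → x ⊖ x ≡ e
  x⊖x≡e = ⊕-inverseʳ

  x⊕e≡x : (x : Cyc m) → x ⊕ e ≡ x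
  x⊕e≡x x = trans (⊕-comm x e) (⊕-identityˡ x)

  x⊖e≡x : (x : Cyc m) → x ⊖ e ≡ x
  x⊖e≡x x = trans (cong (x ⊕_) ε⁻¹≈ε) (x⊕e≡x x)

  [x⊖y]⊕y≡x : (x y : Cyc m) → (x ⊖ y) ⊕ y ≡ x
  [x⊖y]⊕y≡x x y = //-rightDividesˡ y x

  [x⊕y]⊖y≡x : (x y : Cyc m) → (x ⊕ y) ⊖ y ≡ x
  [x⊕y]⊖y≡x x y = //-rightDividesʳ y x

  [x⊕y]⊖x≡y : (x y : Cyc m) → (x ⊕ y) ⊖ x ≡ y
  [x⊕y]⊖x≡y x y = trans (cong (_⊖ x) (⊕-comm x y)) ([x⊕y]⊖y≡x y x)

  x⊕[y⊖x]≡y : (x y : Cyc m) → x ⊕ (y ⊖ x) ≡ y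
  x⊕[y⊖x]≡y x y = trans (⊕-comm x (y ⊖ x)) ([x⊖y]⊕y≡x y x)

  inv[x⊖y]≡y⊖x : (x y : Cyc m) → inv (x ⊖ y) ≡ y ⊖ x
  inv[x⊖y]≡y⊖x = ⁻¹-anti-homo-//

  x⊖inv[x]≡x⊕x : (x : Cyc m) → x ⊖ inv x ≡ x ⊕ x
  x⊖inv[x]≡x⊕x x = cong (x ⊕_) (inv[inv[x]]≡x x)

  x⊕x≡e⇒inv[x]≡x : (x : Cyc m) → x ⊕ x ≡ e → inv x ≡ x
  x⊕x≡e⇒inv[x]≡x x xx≡e = sym (inverseʳ-unique x x xx≡e)

  [x⊖y]⊕[y⊖z]≡x⊖z : (x y z : Cyc m) → (x ⊖ y) ⊕ (y ⊖ z) ≡ x ⊖ z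
  [x⊖y]⊕[y⊖z]≡x⊖z x y z = begin
    (x ⊖ y) ⊕ (y ⊕ inv z)  ≡⟨ ⊕-assoc (x ⊖ y) y (inv z) ⟨
    ((x ⊖ y) ⊕ y) ⊕ inv z  ≡⟨ cong (_⊖ z) ([x⊖y]⊕y≡x x y) ⟩
    x ⊖ z                  ∎

  x⊕[[y⊖x]⊕z]≡y⊕z : (x y z : Cyc m) → x ⊕ ((y ⊖ x) ⊕ z) ≡ y ⊕ z
  x⊕[[y⊖x]⊕z]≡y⊕z x y z = trans (sym (⊕-assoc x (y ⊖ x) z)) (cong (_⊕ z) (x⊕[y⊖x]≡y x y))

  ⊖-interchange : (a b c d : Cyc m) → (a ⊕ b) ⊖ (c ⊕ d) ≡ (a ⊖ c) ⊕ (b ⊖ d)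
  ⊖-interchange a b c d = begin
    (a ⊕ b) ⊕ inv (c ⊕ d)      ≡⟨ cong ((a ⊕ b) ⊕_) (⁻¹-∙-comm c d) ⟨
    (a ⊕ b) ⊕ (inv c ⊕ inv d)  ≡⟨ interchange a b (inv c) (inv d) ⟩
    (a ⊖ c) ⊕ (b ⊖ d)          ∎

-- x ≈ y abbreviates P (x ⊖ y) ≡ true: x and y lie in one coset of P.
module AGroup {m : ℕ} {A : SRing m} {P : Subset m} (P-grp : IsAGroup A P) where
  open IsAGroup P-grp

  ⊖-closed : ∀ x y → P x ≡ true → P y ≡ true → P (x ⊖ y) ≡ true
  ⊖-closed x y x∈P y∈P = ⊕-closed x (inv y) x∈P (inv-closedH y y∈P)

  ≈-refl : ∀ x → P (x ⊖ x) ≡ true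
  ≈-refl x = subst (λ z → P z ≡ true) (sym (x⊖x≡e x)) has-e

  ≈-sym : ∀ x y → P (x ⊖ y) ≡ true → P (y ⊖ x) ≡ true
  ≈-sym x y x≈y = subst (λ z → P z ≡ true) (inv[x⊖y]≡y⊖x x y) (inv-closedH _ x≈y)

  ≈-trans : ∀ x y z → P (x ⊖ y) ≡ true → P (y ⊖ z) ≡ true → P (x ⊖ z) ≡ true
  ≈-trans x y z x≈y y≈z =
    subst (λ w → P w ≡ true) ([x⊖y]⊕[y⊖z]≡x⊖z x y z) (⊕-closed _ _ x≈y y≈z)

  ≈-⊕ : ∀ x y x' y' → P (x ⊖ y) ≡ true → P (x' ⊖ y') ≡ true →
        P ((x ⊕ x') ⊖ (y ⊕ y')) ≡ true
  ≈-⊕ x y x' y' x≈y x'≈y' =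
    subst (λ w → P w ≡ true) (sym (⊖-interchange x x' y y')) (⊕-closed _ _ x≈y x'≈y')

  ⊕-≈ : ∀ x l → P l ≡ true → P ((x ⊕ l) ⊖ x) ≡ true
  ⊕-≈ x l l∈P = subst (λ w → P w ≡ true) (sym ([x⊕y]⊖x≡y x l)) l∈P

  inv-member : ∀ x → P (inv x) ≡ P x
  inv-member x = ⇔→≡ {z = true} (mk⇔
    (λ inv[x]∈P → subst (λ w → P w ≡ true) (inv[inv[x]]≡x x) (inv-closedH (inv x) inv[x]∈P))
    (inv-closedH x))

  ≈-member : ∀ x y → P (x ⊖ y) ≡ true → P x ≡ P y
  ≈-member x y x≈y = ⇔→≡ {z = true} (mk⇔
    (λ x∈P → subst (λ w → P w ≡ true) ([x⊖y]⊕y≡x y x) (⊕-closed _ _ (≈-sym x y x≈y) x∈P))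
    (λ y∈P → subst (λ w → P w ≡ true) ([x⊖y]⊕y≡x x y) (⊕-closed _ _ x≈y y∈P)))

Trivial⇒≡e : ∀ {m} (x : Cyc m) → Trivial x ≡ true → x ≡ e
Trivial⇒≡e zero    _ = refl
Trivial⇒≡e (suc x) ()

≡e⇒Trivial : ∀ {m} (x : Cyc m) → x ≡ e → Trivial x ≡ true
≡e⇒Trivial _ refl = refl

module _ {X : Set} where
  open import Data.List.Membership.Propositional using (_∈_)
  open import Data.List.Relation.Unary.Any using (here; there)

  countIn : (X → Bool) → List X → ℕ
  countIn p xs = sum (map (λ x → if p x then 1 else 0) xs)

  countIn-witness : ∀ p xs → 1 ≤ countIn p xs → Σ X λ x → p x ≡ true
  countIn-witness p (x ∷ xs) h with p x in px
  ... | true  = x , px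
  ... | false = countIn-witness p xs h

  countIn-pos : ∀ p xs {x} → x ∈ xs → p x ≡ true → 1 ≤ countIn p xs
  countIn-pos p (x ∷ xs) (here refl) px rewrite px = s≤s z≤n
  countIn-pos p (y ∷ xs) (there x∈xs) px =
    ≤-trans (countIn-pos p xs x∈xs px) (m≤n+m _ (if p y then 1 else 0))

  countIn-mono : ∀ p q xs → (∀ x → p x ≡ true → q x ≡ true) → countIn p xs ≤ countIn q xs
  countIn-mono p q []       p⊆q = z≤n
  countIn-mono p q (x ∷ xs) p⊆q with p x in px
  ... | true rewrite p⊆q x px = s≤s (countIn-mono p q xs p⊆q)
  ... | false = ≤-trans (countIn-mono p q xs p⊆q) (m≤n+m _ (if q x then 1 else 0))

  countIn-∨ : ∀ p q xs → (∀ x → p x ≡ true → q x ≡ true → ⊥) →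
              countIn (λ x → p x ∨ q x) xs ≡ countIn p xs + countIn q xs
  countIn-∨ p q []       disjoint = refl
  countIn-∨ p q (x ∷ xs) disjoint with p x in px | q x in qx
  ... | true  | true  = ⊥-elim (disjoint x px qx)
  ... | true  | false = cong suc (countIn-∨ p q xs disjoint)
  ... | false | true  = trans (cong suc (countIn-∨ p q xs disjoint)) (sym (+-suc _ _))
  ... | false | false = countIn-∨ p q xs disjoint

list-sum≡∑ : ∀ {n} (h : Fin n → ℕ) → sum (map h (allFin n)) ≡ ∑ h
list-sum≡∑ {n} h = go n id
  where
  go : ∀ k (f : Fin k → Fin n) → sum (map h (tabulate f)) ≡ ∑ (h ∘ f)
  go ℕ.zero    f = refl
  go (ℕ.suc k) f = cong (h (f zero) +_) (go k (f ∘ suc))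

module _ {m : ℕ} where
  open import Data.List.Membership.Propositional.Properties using (∈-allFin)

  count-witness : (p : Subset m) → 1 ≤ count p → Σ (Cyc m) λ x → p x ≡ true
  count-witness p = countIn-witness p (allFin (suc m))

  count-pos : (p : Subset m) (x : Cyc m) → p x ≡ true → 1 ≤ count p
  count-pos p x = countIn-pos p (allFin (suc m)) (∈-allFin x)

  count-mono : (p q : Subset m) → (∀ x → p x ≡ true → q x ≡ true) → count p ≤ count q
  count-mono p q = countIn-mono p q (allFin (suc m))

  count-∨ : (p q : Subset m) → (∀ x → p x ≡ true → q x ≡ true → ⊥) →
            count (λ x → p x ∨ q x) ≡ count p + count q
  count-∨ p q = countIn-∨ p q (allFin (suc m))

  count-⊖ : (p : Subset m) (c : Cyc m) → count (λ y → p (y ⊖ c)) ≡ count p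
  count-⊖ p c = begin
    count (λ y → p (y ⊖ c))  ≡⟨ list-sum≡∑ (indicator ∘ (_⊖ c)) ⟩
    ∑ (indicator ∘ (_⊖ c))   ≡⟨ sum-permute indicator translation ⟨
    ∑ indicator              ≡⟨ list-sum≡∑ indicator ⟨
    count p                  ∎
    where
    open ≡-Reasoning
    indicator : Cyc m → ℕ
    indicator x = if p x then 1 else 0
    translation = permutation (_⊖ c) (_⊕ c) (λ y → [x⊕y]⊖y≡x y c) (λ y → [x⊖y]⊕y≡x y c)

module BasicSets {m : ℕ} (A : SRing m) where
  private
    ≡ᵇ-intro : ∀ x y → x ≡ y → (x ≡ᵇ y) ≡ true
    ≡ᵇ-intro x y x≡y = Equivalence.to T-≡ (≡⇒≡ᵇ x y x≡y)

    ≡ᵇ-elim : ∀ x y → (x ≡ᵇ y) ≡ true → x ≡ y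
    ≡ᵇ-elim x y x≡ᵇy = ≡ᵇ⇒≡ x y (Equivalence.from T-≡ x≡ᵇy)

  -- The coefficient of z in X̲ · Y̲ (X ∋ a, Y ∋ b) counts the x ∈ X with z ⊖ x ∈ Y;
  -- it is positive at z = a ⊕ b, hence on the whole basic set of a ⊕ b.
  basic-sum-decomposition : ∀ a b z → cls A (a ⊕ b) ≡ cls A z →
    Σ (Cyc m) λ a' → cls A a' ≡ cls A a × cls A (z ⊖ a') ≡ cls A b
  basic-sum-decomposition a b z a⊕b~z =
    a' , ≡ᵇ-elim _ _ (proj₁ (∧-elim a'-ok)) , ≡ᵇ-elim _ _ (proj₂ (∧-elim a'-ok))
    where
    coefficient : Cyc m → Subset m
    coefficient w x = (cls A x ≡ᵇ cls A a) ∧ (cls A (w ⊖ x) ≡ᵇ cls A b)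
    positive-at-a⊕b : 1 ≤ count (coefficient (a ⊕ b))
    positive-at-a⊕b = count-pos (coefficient (a ⊕ b)) a
      (∧-intro (≡ᵇ-intro (cls A a) _ refl) (≡ᵇ-intro _ (cls A b) (cong (cls A) ([x⊕y]⊖x≡y a b))))
    witness = count-witness (coefficient z)
      (subst (1 ≤_) (ring-closed A a b (a ⊕ b) z a⊕b~z) positive-at-a⊕b)
    a' = proj₁ witness
    a'-ok = proj₂ witness

  singleton-translation : ∀ s → (∀ x → cls A x ≡ cls A s → x ≡ s) →
    ∀ x y → cls A x ≡ cls A y → cls A (x ⊖ s) ≡ cls A (y ⊖ s)
  singleton-translation s thin x y x~y =
    sym (subst (λ a' → cls A (y ⊖ a') ≡ cls A (x ⊖ s)) (thin s' s'~s) y⊖s'~x⊖s)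
    where
    decomposition = basic-sum-decomposition s (x ⊖ s) y (trans (cong (cls A) (x⊕[y⊖x]≡y s x)) x~y)
    s' = proj₁ decomposition
    s'~s = proj₁ (proj₂ decomposition)
    y⊖s'~x⊖s = proj₂ (proj₂ decomposition)

module _ {m : ℕ} {A : SRing m} (S : Section A) where
  open BasicSets A
  open IsAGroup (L-grp S)
  private module L = AGroup (L-grp S)

  cls⇒SameBasic : ∀ u v → cls A u ≡ cls A v → SameBasic S u v
  cls⇒SameBasic u v u~v =
    e , e , has-e , has-e , trans (cong (cls A) (x⊕e≡x u)) (trans u~v (cong (cls A) (sym (x⊕e≡x v))))

  SameBasic-resp : ∀ u v u' v' → u ≈[ S ] u' → v ≈[ S ] v' → SameBasic S u v → SameBasic S u' v'
  SameBasic-resp u v u' v' u≈u' v≈v' (l , l' , l∈L , l'∈L , u⊕l~v⊕l') =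
    (u ⊖ u') ⊕ l , (v ⊖ v') ⊕ l' , ⊕-closed _ _ u≈u' l∈L , ⊕-closed _ _ v≈v' l'∈L ,
    trans (cong (cls A) (x⊕[[y⊖x]⊕z]≡y⊕z u' u l))
      (trans u⊕l~v⊕l' (cong (cls A) (sym (x⊕[[y⊖x]⊕z]≡y⊕z v' v l'))))

  SameBasic⇒L≡ : ∀ u v → SameBasic S u v → L S u ≡ L S v
  SameBasic⇒L≡ u v (l , l' , l∈L , l'∈L , u⊕l~v⊕l') = begin
    L S u         ≡⟨ L.≈-member (u ⊕ l) u (L.⊕-≈ u l l∈L) ⟨
    L S (u ⊕ l)   ≡⟨ union-of-basic _ _ u⊕l~v⊕l' ⟩
    L S (v ⊕ l')  ≡⟨ L.≈-member (v ⊕ l') v (L.⊕-≈ v l' l'∈L) ⟩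
    L S v         ∎
    where open ≡-Reasoning

  SameBasic⇒representative : ∀ u v → SameBasic S u v →
    Σ (Cyc m) λ y → cls A y ≡ cls A u × y ≈[ S ] v
  SameBasic⇒representative u v (l , l' , l∈L , l'∈L , u⊕l~v⊕l') =
    y , y~u , L.≈-trans y (v ⊕ l') v (L.≈-sym (v ⊕ l') y [v⊕l']⊖y∈L) (L.⊕-≈ v l' l'∈L)
    where
    decomposition = basic-sum-decomposition u l (v ⊕ l') u⊕l~v⊕l'
    y = proj₁ decomposition
    y~u = proj₁ (proj₂ decomposition)
    [v⊕l']⊖y∈L : L S ((v ⊕ l') ⊖ y) ≡ true
    [v⊕l']⊖y∈L = trans (union-of-basic _ _ (proj₂ (proj₂ decomposition))) l∈L

  representative⇒SameBasic : ∀ u v y → cls A y ≡ cls A u → y ≈[ S ] v → SameBasic S u v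
  representative⇒SameBasic u v y y~u y≈v =
    e , y ⊖ v , has-e , y≈v ,
    trans (cong (cls A) (x⊕e≡x u)) (trans (sym y~u) (cong (cls A) (sym (x⊕[y⊖x]≡y v y))))

-- The graph, on representatives, of an isomorphism U/L → U'/L' mapping the
-- basic sets of 𝒜_{U/L} onto those of 𝒜_{U'/L'}.
record SectionIso {m : ℕ} {A : SRing m} (S S' : Section A) : Set₁ where
  field
    R               : Cyc m → Cyc m → Set
    R⇒U             : ∀ {u w} → R u w → U S u ≡ true × U S' w ≡ true
    total           : ∀ u → U S u ≡ true → Σ (Cyc m) (R u)
    surjective      : ∀ w → U S' w ≡ true → Σ (Cyc m) λ u → R u w
    ≈-preserved     : ∀ {u w u' w'} → R u w → R u' w' → u ≈[ S ] u' → w ≈[ S' ] w'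
    ≈-reflected     : ∀ {u w u' w'} → R u w → R u' w' → w ≈[ S' ] w' → u ≈[ S ] u'
    ⊕-preserved     : ∀ {u w u' w'} → R u w → R u' w' → R (u ⊕ u') (w ⊕ w')
    basic-preserved : ∀ {u w u' w'} → R u w → R u' w' → SameBasic S u u' → SameBasic S' w w'
    basic-reflected : ∀ {u w u' w'} → R u w → R u' w' → SameBasic S' w w' → SameBasic S u u'

module _ {m : ℕ} {A : SRing m} where
  open SectionIso
  private variable S S' S'' : Section A

  SectionIso-refl : SectionIso S S
  SectionIso-refl {S} = record
    { R               = λ u w → U S u ≡ true × u ≡ w
    ; R⇒U             = λ { (u∈U , refl) → u∈U , u∈U }
    ; total           = λ u u∈U → u , u∈U , refl
    ; surjective      = λ u u∈U → u , u∈U , refl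
    ; ≈-preserved     = λ { (_ , refl) (_ , refl) → id }
    ; ≈-reflected     = λ { (_ , refl) (_ , refl) → id }
    ; ⊕-preserved     = λ { (u∈U , refl) (u'∈U , refl) → IsAGroup.⊕-closed (U-grp S) _ _ u∈U u'∈U , refl }
    ; basic-preserved = λ { (_ , refl) (_ , refl) → id }
    ; basic-reflected = λ { (_ , refl) (_ , refl) → id }
    }

  SectionIso-sym : SectionIso S S' → SectionIso S' S
  SectionIso-sym σ = record
    { R               = λ u w → R σ w u
    ; R⇒U             = λ r → proj₂ (R⇒U σ r) , proj₁ (R⇒U σ r)
    ; total           = surjective σ
    ; surjective      = total σ
    ; ≈-preserved     = ≈-reflected σ
    ; ≈-reflected     = ≈-preserved σ
    ; ⊕-preserved     = ⊕-preserved σ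
    ; basic-preserved = basic-reflected σ
    ; basic-reflected = basic-preserved σ
    }

  SectionIso-trans : SectionIso S S' → SectionIso S' S'' → SectionIso S S''
  SectionIso-trans σ τ = record
    { R               = λ u w → Σ (Cyc m) λ v → R σ u v × R τ v w
    ; R⇒U             = λ { (v , r , s) → proj₁ (R⇒U σ r) , proj₂ (R⇒U τ s) }
    ; total           = λ u u∈U →
        let (v , r) = total σ u u∈U ; (w , s) = total τ v (proj₂ (R⇒U σ r)) in w , v , r , s
    ; surjective      = λ w w∈U →
        let (v , s) = surjective τ w w∈U ; (u , r) = surjective σ v (proj₁ (R⇒U τ s)) in u , v , r , s
    ; ≈-preserved     = λ { (_ , r , s) (_ , r' , s') → ≈-preserved τ s s' ∘ ≈-preserved σ r r' }
    ; ≈-reflected     = λ { (_ , r , s) (_ , r' , s') → ≈-reflected σ r r' ∘ ≈-reflected τ s s' }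
    ; ⊕-preserved     = λ { (v , r , s) (v' , r' , s') → v ⊕ v' , ⊕-preserved σ r r' , ⊕-preserved τ s s' }
    ; basic-preserved = λ { (_ , r , s) (_ , r' , s') → basic-preserved τ s s' ∘ basic-preserved σ r r' }
    ; basic-reflected = λ { (_ , r , s) (_ , r' , s') → basic-reflected σ r r' ∘ basic-reflected τ s s' }
    }

  SectionIso-isEquivalence : IsEquivalence (SectionIso {A = A})
  SectionIso-isEquivalence = record
    { refl = SectionIso-refl ; sym = SectionIso-sym ; trans = SectionIso-trans }

  L-preserved : (σ : SectionIso S S') → ∀ {u w} → R σ u w → L S u ≡ true → L S' w ≡ true
  L-preserved {S} {S'} σ {u} {w} r u∈L =
    trans (S'.≈-member w w₀ (≈-preserved σ r r₀ u≈e)) w₀∈L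
    where
    module S = AGroup (L-grp S)
    module S' = AGroup (L-grp S')
    e∈U = IsAGroup.has-e (U-grp S)
    w₀ = proj₁ (total σ e e∈U)
    r₀ = proj₂ (total σ e e∈U)
    u≈e : u ≈[ S ] e
    u≈e = subst (λ z → L S z ≡ true) (sym (x⊖e≡x u)) u∈L
    e⊕e≈e : (e ⊕ e) ≈[ S ] e
    e⊕e≈e = S.⊕-≈ e e (IsAGroup.has-e (L-grp S))
    w₀∈L : L S' w₀ ≡ true
    w₀∈L = subst (λ z → L S' z ≡ true) ([x⊕y]⊖y≡x w₀ w₀)
      (≈-preserved σ (⊕-preserved σ r₀ r₀) r₀ e⊕e≈e)

  L-equal : (σ : SectionIso S S') → ∀ {u w} → R σ u w → L S u ≡ L S' w
  L-equal σ r = ⇔→≡ {z = true} (mk⇔ (L-preserved σ r) (L-preserved (SectionIso-sym σ) r))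

module _ {m : ℕ} {A : SRing m} {S₁ S₂ : Section A} (step : S₁ ⟶ S₂) where
  private
    module L₂ = AGroup (L-grp S₂)
    module U₁ = AGroup (U-grp S₁)

    U₁∩L₂≡L₁ : ∀ x → (U S₁ x ∧ L S₂ x) ≡ L S₁ x
    U₁∩L₂≡L₁ = proj₁ step

    U₁L₂⊆U₂ : ∀ u l → U S₁ u ≡ true → L S₂ l ≡ true → U S₂ (u ⊕ l) ≡ true
    U₁L₂⊆U₂ u l = proj₂ (proj₂ step u) u l

    U₂⊆U₁L₂ : ∀ w → U S₂ w ≡ true →
      Σ (Cyc m) λ u → Σ (Cyc m) λ l → U S₁ u ≡ true × L S₂ l ≡ true × w ≡ u ⊕ l
    U₂⊆U₁L₂ w = proj₁ (proj₂ step w)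

  L₁⊆L₂ : ∀ x → L S₁ x ≡ true → L S₂ x ≡ true
  L₁⊆L₂ x x∈L₁ = proj₂ (∧-elim (trans (U₁∩L₂≡L₁ x) x∈L₁))

  U₁∩L₂⊆L₁ : ∀ x → U S₁ x ≡ true → L S₂ x ≡ true → L S₁ x ≡ true
  U₁∩L₂⊆L₁ x x∈U₁ x∈L₂ = trans (sym (U₁∩L₂≡L₁ x)) (cong₂ _∧_ x∈U₁ x∈L₂)

  U₁⊆U₂ : ∀ u → U S₁ u ≡ true → U S₂ u ≡ true
  U₁⊆U₂ u u∈U₁ =
    subst (λ z → U S₂ z ≡ true) (x⊕e≡x u) (U₁L₂⊆U₂ u e u∈U₁ (IsAGroup.has-e (L-grp S₂)))

  -- A representative of u'L₂ in the basic set of u lies in U₁, hence in u'L₁.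
  SameBasic-restrict : ∀ u u' → U S₁ u ≡ true → U S₁ u' ≡ true →
    SameBasic S₂ u u' → SameBasic S₁ u u'
  SameBasic-restrict u u' u∈U₁ u'∈U₁ same₂ = representative⇒SameBasic S₁ u u' y y~u
    (U₁∩L₂⊆L₁ (y ⊖ u') (U₁.⊖-closed y u' y∈U₁ u'∈U₁) (proj₂ (proj₂ representative)))
    where
    representative = SameBasic⇒representative S₂ u u' same₂
    y = proj₁ representative
    y~u = proj₁ (proj₂ representative)
    y∈U₁ : U S₁ y ≡ true
    y∈U₁ = trans (IsAGroup.union-of-basic (U-grp S₁) y u y~u) u∈U₁

  SameBasic-extend : ∀ u u' → SameBasic S₁ u u' → SameBasic S₂ u u'
  SameBasic-extend u u' (l , l' , l∈L₁ , l'∈L₁ , same) = l , l' , L₁⊆L₂ l l∈L₁ , L₁⊆L₂ l' l'∈L₁ , same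

  ⟶⇒SectionIso : SectionIso S₁ S₂
  ⟶⇒SectionIso = record
    { R               = λ u w → U S₁ u ≡ true × U S₂ w ≡ true × u ≈[ S₂ ] w
    ; R⇒U             = λ (u∈U₁ , w∈U₂ , _) → u∈U₁ , w∈U₂
    ; total           = λ u u∈U₁ → u , u∈U₁ , U₁⊆U₂ u u∈U₁ , L₂.≈-refl u
    ; surjective      = λ w w∈U₂ → let (u , l , u∈U₁ , l∈L₂ , w≡u⊕l) = U₂⊆U₁L₂ w w∈U₂ in
        u , u∈U₁ , w∈U₂ ,
        subst (λ z → u ≈[ S₂ ] z) (sym w≡u⊕l) (L₂.≈-sym (u ⊕ l) u (L₂.⊕-≈ u l l∈L₂))
    ; ≈-preserved     = λ { {u} {w} {u'} {w'} (_ , _ , u≈w) (_ , _ , u'≈w') u≈₁u' →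
        L₂.≈-trans w u w' (L₂.≈-sym u w u≈w)
          (L₂.≈-trans u u' w' (L₁⊆L₂ (u ⊖ u') u≈₁u') u'≈w') }
    ; ≈-reflected     = λ { {u} {w} {u'} {w'} (u∈U₁ , _ , u≈w) (u'∈U₁ , _ , u'≈w') w≈w' →
        U₁∩L₂⊆L₁ (u ⊖ u') (U₁.⊖-closed u u' u∈U₁ u'∈U₁)
          (L₂.≈-trans u w u' u≈w (L₂.≈-trans w w' u' w≈w' (L₂.≈-sym u' w' u'≈w'))) }
    ; ⊕-preserved     = λ { {u} {w} {u'} {w'} (u∈U₁ , w∈U₂ , u≈w) (u'∈U₁ , w'∈U₂ , u'≈w') →
        IsAGroup.⊕-closed (U-grp S₁) u u' u∈U₁ u'∈U₁ ,
        IsAGroup.⊕-closed (U-grp S₂) w w' w∈U₂ w'∈U₂ ,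
        L₂.≈-⊕ u w u' w' u≈w u'≈w' }
    ; basic-preserved = λ { {u} {w} {u'} {w'} (_ , _ , u≈w) (_ , _ , u'≈w') same₁ →
        SameBasic-resp S₂ u u' w w' u≈w u'≈w' (SameBasic-extend u u' same₁) }
    ; basic-reflected = λ { {u} {w} {u'} {w'} (u∈U₁ , _ , u≈w) (u'∈U₁ , _ , u'≈w') same₂ →
        SameBasic-restrict u u' u∈U₁ u'∈U₁
          (SameBasic-resp S₂ w w' u u' (L₂.≈-sym u w u≈w) (L₂.≈-sym u' w' u'≈w') same₂) }
    }

ProjEq⇒SectionIso : ∀ {m} {A : SRing m} {S S' : Section A} → ProjEq S S' → SectionIso S S'
ProjEq⇒SectionIso = fold SectionIso-isEquivalence ⟶⇒SectionIso

record IndexAtMostTwo {m : ℕ} {A : SRing m} (S : Section A) : Set where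
  field
    u     : Cyc m
    u∈U   : U S u ≡ true
    cover : ∀ x → U S x ≡ true → L S x ≡ false → x ≈[ S ] u

module _ {m : ℕ} {A : SRing m} (S : Section A) where
  private
    module L = AGroup (L-grp S)

    coset : Cyc m → Subset m
    coset a y = L S (y ⊖ a)

    coset⊆U : ∀ a y → U S a ≡ true → coset a y ≡ true → U S y ≡ true
    coset⊆U a y a∈U y≈a = subst (λ z → U S z ≡ true) ([x⊖y]⊕y≡x y a)
      (IsAGroup.⊕-closed (U-grp S) _ _ (L⊆U S _ y≈a) a∈U)

    cosets-disjoint : ∀ a b → L S (b ⊖ a) ≡ false → ∀ y → coset a y ≡ true → coset b y ≡ true → ⊥
    cosets-disjoint a b b≉a y y≈a y≈b with trans (sym b≉a) (L.≈-trans b y a (L.≈-sym y b y≈b) y≈a)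
    ... | ()

  three-cosets : ∀ a b c → U S a ≡ true → U S b ≡ true → U S c ≡ true →
    L S (b ⊖ a) ≡ false → L S (c ⊖ a) ≡ false → L S (c ⊖ b) ≡ false →
    3 * count (L S) ≤ count (U S)
  three-cosets a b c a∈U b∈U c∈U b≉a c≉a c≉b = begin
    3 * |L|                                                ≡⟨ cong (λ k → |L| + (|L| + k)) (+-identityʳ |L|) ⟩
    |L| + (|L| + |L|)                                      ≡⟨ cong₂ _+_ (|coset| a) (cong₂ _+_ (|coset| b) (|coset| c)) ⟨
    count (coset a) + (count (coset b) + count (coset c))  ≡⟨ |union| ⟨
    count union                                            ≤⟨ count-mono union (U S) union⊆U ⟩
    count (U S)                                            ∎
    where
    open ≤-Reasoning
    |L| = count (L S)
    |coset| : ∀ a → count (coset a) ≡ |L|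
    |coset| a = count-⊖ (L S) a
    union : Subset m
    union y = coset a y ∨ (coset b y ∨ coset c y)
    a-disjoint : ∀ y → coset a y ≡ true → (coset b y ∨ coset c y) ≡ true → ⊥
    a-disjoint y y≈a y≈b∨c with ∨-elim y≈b∨c
    ... | inj₁ y≈b = cosets-disjoint a b b≉a y y≈a y≈b
    ... | inj₂ y≈c = cosets-disjoint a c c≉a y y≈a y≈c
    |union| : count union ≡ count (coset a) + (count (coset b) + count (coset c))
    |union| = trans (count-∨ (coset a) _ a-disjoint)
      (cong (count (coset a) +_) (count-∨ (coset b) (coset c) (cosets-disjoint b c c≉b)))
    union⊆U : ∀ y → union y ≡ true → U S y ≡ true
    union⊆U y y∈union with ∨-elim y∈union
    ... | inj₁ y≈a = coset⊆U a y a∈U y≈a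
    ... | inj₂ y≈b∨c with ∨-elim y≈b∨c
    ... | inj₁ y≈b = coset⊆U b y b∈U y≈b
    ... | inj₂ y≈c = coset⊆U c y c∈U y≈c

  order≡2⇒IndexAtMostTwo : order≡ S 2 → IndexAtMostTwo S
  order≡2⇒IndexAtMostTwo |U|≡2|L| with any? (λ x → (U S x ≟ true) ×-dec (L S x ≟ false))
  ... | no ∄u = record
    { u = e ; u∈U = IsAGroup.has-e (U-grp S) ; cover = λ x x∈U x∉L → ⊥-elim (∄u (x , x∈U , x∉L)) }
  ... | yes (u , u∈U , u∉L) = record { u = u ; u∈U = u∈U ; cover = cover }
    where
    instance
      |L|≢0 : NonZero (count (L S))
      |L|≢0 = >-nonZero (count-pos (L S) e (IsAGroup.has-e (L-grp S)))
    cover : ∀ x → U S x ≡ true → L S x ≡ false → x ≈[ S ] u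
    -- Otherwise e, u and x would represent three distinct cosets of L in U.
    cover x x∈U x∉L with L S (x ⊖ u) in x⊖u∈L
    ... | true  = refl
    ... | false = ⊥-elim (3≰2 (*-cancelʳ-≤ 3 2 (count (L S)) 3|L|≤2|L|))
      where
      3≰2 : 3 ≤ 2 → ⊥
      3≰2 (s≤s (s≤s ()))
      3|L|≤2|L| : 3 * count (L S) ≤ 2 * count (L S)
      3|L|≤2|L| = subst (3 * count (L S) ≤_) |U|≡2|L|
        (three-cosets e u x (IsAGroup.has-e (U-grp S)) u∈U x∈U
          (trans (cong (L S) (x⊖e≡x u)) u∉L) (trans (cong (L S) (x⊖e≡x x)) x∉L) x⊖u∈L)

IndexAtMostTwo-transport : ∀ {m} {A : SRing m} {S S' : Section A} →
  SectionIso S S' → IndexAtMostTwo S' → IndexAtMostTwo S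
IndexAtMostTwo-transport {S = S} {S'} σ index = record
  { u = a ; u∈U = proj₁ (R⇒U ra) ; cover = cover }
  where
  open SectionIso σ
  open IndexAtMostTwo index renaming (u to u'; u∈U to u'∈U; cover to cover')
  a = proj₁ (surjective u' u'∈U)
  ra = proj₂ (surjective u' u'∈U)
  cover : ∀ x → U S x ≡ true → L S x ≡ false → x ≈[ S ] a
  cover x x∈U x∉L = ≈-reflected rx ra
    (cover' w (proj₂ (R⇒U rx)) (trans (sym (L-equal σ rx)) x∉L))
    where
    w = proj₁ (total x x∈U)
    rx = proj₂ (total x x∈U)

module DirectProduct {m : ℕ} {A : SRing m} {H H' : Subset m}
  (H-grp : IsAGroup A H) (complement : IsAComplement A H H') where
  private module H = AGroup H-grp

  H'-grp : IsAGroup A H'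
  H'-grp = proj₁ complement

  private module H' = AGroup H'-grp

  H∩H'⊆e : ∀ x → H x ≡ true → H' x ≡ true → x ≡ e
  H∩H'⊆e = proj₁ (proj₂ complement)

  private
    decompose : ∀ g → Σ (Cyc m) λ h → Σ (Cyc m) λ h' → H h ≡ true × H' h' ≡ true × g ≡ h ⊕ h'
    decompose = proj₂ (proj₂ complement)

  πH : Cyc m → Cyc m
  πH g = proj₁ (decompose g)

  πH' : Cyc m → Cyc m
  πH' g = proj₁ (proj₂ (decompose g))

  πH∈H : ∀ g → H (πH g) ≡ true
  πH∈H g = proj₁ (proj₂ (proj₂ (decompose g)))

  πH'∈H' : ∀ g → H' (πH' g) ≡ true
  πH'∈H' g = proj₁ (proj₂ (proj₂ (proj₂ (decompose g))))

  πH⊕πH' : ∀ g → g ≡ πH g ⊕ πH' g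
  πH⊕πH' g = proj₂ (proj₂ (proj₂ (proj₂ (decompose g))))

  decomposition-unique : ∀ h₁ h₁' h₂ h₂' →
    H h₁ ≡ true → H' h₁' ≡ true → H h₂ ≡ true → H' h₂' ≡ true →
    h₁ ⊕ h₁' ≡ h₂ ⊕ h₂' → h₁ ≡ h₂ × h₁' ≡ h₂'
  decomposition-unique h₁ h₁' h₂ h₂' h₁∈H h₁'∈H' h₂∈H h₂'∈H' h₁⊕h₁'≡h₂⊕h₂' =
    h₁≡h₂ , ⊕-cancelˡ h₂ h₁' h₂' (trans (cong (_⊕ h₁') (sym h₁≡h₂)) h₁⊕h₁'≡h₂⊕h₂')
    where
    open ≡-Reasoning
    h₁⊖h₂≡h₂'⊖h₁' : h₁ ⊖ h₂ ≡ h₂' ⊖ h₁'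
    h₁⊖h₂≡h₂'⊖h₁' = begin
      h₁ ⊖ h₂                    ≡⟨ x⊕e≡x (h₁ ⊖ h₂) ⟨
      (h₁ ⊖ h₂) ⊕ e              ≡⟨ cong ((h₁ ⊖ h₂) ⊕_) (x⊖x≡e h₁') ⟨
      (h₁ ⊖ h₂) ⊕ (h₁' ⊖ h₁')    ≡⟨ ⊖-interchange h₁ h₁' h₂ h₁' ⟨
      (h₁ ⊕ h₁') ⊖ (h₂ ⊕ h₁')    ≡⟨ cong (_⊖ (h₂ ⊕ h₁')) h₁⊕h₁'≡h₂⊕h₂' ⟩
      (h₂ ⊕ h₂') ⊖ (h₂ ⊕ h₁')    ≡⟨ ⊖-interchange h₂ h₂' h₂ h₁' ⟩
      (h₂ ⊖ h₂) ⊕ (h₂' ⊖ h₁')    ≡⟨ cong (_⊕ (h₂' ⊖ h₁')) (x⊖x≡e h₂) ⟩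
      e ⊕ (h₂' ⊖ h₁')            ≡⟨ ⊕-identityˡ (h₂' ⊖ h₁') ⟩
      h₂' ⊖ h₁'                  ∎
    h₁≡h₂ : h₁ ≡ h₂
    h₁≡h₂ = x⊖y≡e⇒x≡y h₁ h₂ (H∩H'⊆e (h₁ ⊖ h₂) (H.⊖-closed h₁ h₂ h₁∈H h₂∈H)
      (subst (λ z → H' z ≡ true) (sym h₁⊖h₂≡h₂'⊖h₁') (H'.⊖-closed h₂' h₁' h₂'∈H' h₁'∈H')))

  πH-unique : ∀ g h h' → H h ≡ true → H' h' ≡ true → g ≡ h ⊕ h' → πH g ≡ h × πH' g ≡ h'
  πH-unique g h h' h∈H h'∈H' g≡h⊕h' = decomposition-unique (πH g) (πH' g) h h'
    (πH∈H g) (πH'∈H' g) h∈H h'∈H' (trans (sym (πH⊕πH' g)) g≡h⊕h')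

  πH-⊕ : ∀ g g' → πH (g ⊕ g') ≡ πH g ⊕ πH g'
  πH-⊕ g g' = proj₁ (πH-unique (g ⊕ g') (πH g ⊕ πH g') (πH' g ⊕ πH' g')
    (IsAGroup.⊕-closed H-grp _ _ (πH∈H g) (πH∈H g'))
    (IsAGroup.⊕-closed H'-grp _ _ (πH'∈H' g) (πH'∈H' g'))
    (trans (cong₂ _⊕_ (πH⊕πH' g) (πH⊕πH' g')) (⊕-interchange (πH g) (πH' g) (πH g') (πH' g'))))

  πH'-coset : ∀ x y → H (x ⊖ y) ≡ true → πH' x ≡ πH' y
  πH'-coset x y x≈y = proj₂ (πH-unique x ((x ⊖ y) ⊕ πH y) (πH' y)
    (IsAGroup.⊕-closed H-grp _ _ x≈y (πH∈H y)) (πH'∈H' y) x≡[x⊖y⊕πHy]⊕πH'y)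
    where
    open ≡-Reasoning
    x≡[x⊖y⊕πHy]⊕πH'y : x ≡ ((x ⊖ y) ⊕ πH y) ⊕ πH' y
    x≡[x⊖y⊕πHy]⊕πH'y = begin
      x                          ≡⟨ [x⊖y]⊕y≡x x y ⟨
      (x ⊖ y) ⊕ y                ≡⟨ cong ((x ⊖ y) ⊕_) (πH⊕πH' y) ⟩
      (x ⊖ y) ⊕ (πH y ⊕ πH' y)   ≡⟨ ⊕-assoc (x ⊖ y) (πH y) (πH' y) ⟨
      ((x ⊖ y) ⊕ πH y) ⊕ πH' y   ∎

SameBasic-/1⇒cls : ∀ {m} {A : SRing m} (H : Subset m) (H-grp : IsAGroup A H) x y →
  SameBasic (_/1 {A = A} H H-grp) x y → cls A x ≡ cls A y
SameBasic-/1⇒cls {A = A} H H-grp x y (l , l' , l≡e , l'≡e , x⊕l~y⊕l') = begin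
  cls A x         ≡⟨ cong (cls A) (x⊕e≡x x) ⟨
  cls A (x ⊕ e)   ≡⟨ cong (λ z → cls A (x ⊕ z)) (Trivial⇒≡e l l≡e) ⟨
  cls A (x ⊕ l)   ≡⟨ x⊕l~y⊕l' ⟩
  cls A (y ⊕ l')  ≡⟨ cong (λ z → cls A (y ⊕ z)) (Trivial⇒≡e l' l'≡e) ⟩
  cls A (y ⊕ e)   ≡⟨ cong (cls A) (x⊕e≡x y) ⟩
  cls A y         ∎
  where open ≡-Reasoning

module Splitting {m : ℕ} {A : SRing m} {H H' : Subset m}
  (H-grp : IsAGroup A H) (complement : IsAComplement A H H')
  (index : IndexAtMostTwo (G/_ {A = A} H H-grp)) where
  open DirectProduct H-grp complement
  open BasicSets A
  private
    module H = AGroup H-grp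
    module H' = AGroup H'-grp
  open IndexAtMostTwo index using (u; cover)

  same-coset : ∀ x y → H x ≡ H y → H (x ⊖ y) ≡ true
  same-coset x y Hx≡Hy with H x in x∈H
  ... | true  = H.⊖-closed x y x∈H (sym Hx≡Hy)
  ... | false = H.≈-trans x u y (cover x refl x∈H) (H.≈-sym y u (cover y refl (sym Hx≡Hy)))

  x⊕x∈H : ∀ x → H (x ⊕ x) ≡ true
  x⊕x∈H x = subst (λ z → H z ≡ true) (x⊖inv[x]≡x⊕x x) (same-coset x (inv x) (sym (H.inv-member x)))

  H'-⊕-self : ∀ s → H' s ≡ true → s ⊕ s ≡ e
  H'-⊕-self s s∈H' = H∩H'⊆e (s ⊕ s) (x⊕x∈H s) (IsAGroup.⊕-closed H'-grp s s s∈H' s∈H')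

  H'-inv : ∀ s → H' s ≡ true → inv s ≡ s
  H'-inv s s∈H' = x⊕x≡e⇒inv[x]≡x s (H'-⊕-self s s∈H')

  -- H' has at most one element besides e, and {e} is a basic set, so the
  -- 𝒜-group H' splits into singleton basic sets.
  H'-thin : ∀ s → H' s ≡ true → ∀ x → cls A x ≡ cls A s → x ≡ s
  H'-thin s s∈H' x x~s = x⊖y≡e⇒x≡y x s
    (H∩H'⊆e (x ⊖ s) (same-coset x s Hx≡Hs) (H'.⊖-closed x s x∈H' s∈H'))
    where
    x∈H' : H' x ≡ true
    x∈H' = trans (IsAGroup.union-of-basic H'-grp x s x~s) s∈H'
    ∈H⇔≡e : ∀ y → H' y ≡ true → H y ≡ true ⇔ y ≡ e
    ∈H⇔≡e y y∈H' = mk⇔ (λ y∈H → H∩H'⊆e y y∈H y∈H')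
      (λ y≡e → subst (λ z → H z ≡ true) (sym y≡e) (IsAGroup.has-e H-grp))
    Hx≡Hs : H x ≡ H s
    Hx≡Hs = ⇔→≡ {z = true} (mk⇔
      (λ x∈H → Equivalence.from (∈H⇔≡e s s∈H')
        (unit-basic A s (trans (sym x~s) (cong (cls A) (Equivalence.to (∈H⇔≡e x x∈H') x∈H)))))
      (λ s∈H → Equivalence.from (∈H⇔≡e x x∈H')
        (unit-basic A x (trans x~s (cong (cls A) (Equivalence.to (∈H⇔≡e s s∈H') s∈H))))))

  H'-translation : ∀ s → H' s ≡ true → ∀ x y → cls A x ≡ cls A y → cls A (x ⊕ s) ≡ cls A (y ⊕ s)
  H'-translation s s∈H' x y x~y =
    subst (λ t → cls A (x ⊕ t) ≡ cls A (y ⊕ t)) (H'-inv s s∈H')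
      (singleton-translation s (H'-thin s s∈H') x y x~y)

  πH'-determined : ∀ g g' → H g ≡ H g' → πH' g ≡ πH' g'
  πH'-determined g g' Hg≡Hg' = πH'-coset g g' (same-coset g g' Hg≡Hg')

  πH≡g⊕πH' : ∀ g → πH g ≡ g ⊕ πH' g
  πH≡g⊕πH' g = begin
    πH g                      ≡⟨ x⊕e≡x (πH g) ⟨
    πH g ⊕ e                  ≡⟨ cong (πH g ⊕_) (H'-⊕-self (πH' g) (πH'∈H' g)) ⟨
    πH g ⊕ (πH' g ⊕ πH' g)    ≡⟨ ⊕-assoc (πH g) (πH' g) (πH' g) ⟨
    (πH g ⊕ πH' g) ⊕ πH' g    ≡⟨ cong (_⊕ πH' g) (πH⊕πH' g) ⟨
    g ⊕ πH' g                 ∎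
    where open ≡-Reasoning

  cls-πH : ∀ g g' → cls A g ≡ cls A g' → cls A (πH g) ≡ cls A (πH g')
  cls-πH g g' g~g' = begin
    cls A (πH g)        ≡⟨ cong (cls A) (πH≡g⊕πH' g) ⟩
    cls A (g ⊕ πH' g)   ≡⟨ H'-translation (πH' g) (πH'∈H' g) g g' g~g' ⟩
    cls A (g' ⊕ πH' g)  ≡⟨ cong (λ s → cls A (g' ⊕ s)) (πH'-determined g g' Hg≡Hg') ⟩
    cls A (g' ⊕ πH' g') ≡⟨ cong (cls A) (πH≡g⊕πH' g') ⟨
    cls A (πH g')       ∎
    where
    open ≡-Reasoning
    Hg≡Hg' = IsAGroup.union-of-basic H-grp g g' g~g'

  cls-from-πH : ∀ g g' → H g ≡ H g' → cls A (πH g) ≡ cls A (πH g') → cls A g ≡ cls A g'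
  cls-from-πH g g' Hg≡Hg' πHg~πHg' = begin
    cls A g                  ≡⟨ cong (cls A) (πH⊕πH' g) ⟩
    cls A (πH g ⊕ πH' g)     ≡⟨ H'-translation (πH' g) (πH'∈H' g) (πH g) (πH g') πHg~πHg' ⟩
    cls A (πH g' ⊕ πH' g)    ≡⟨ cong (λ s → cls A (πH g' ⊕ s)) (πH'-determined g g' Hg≡Hg') ⟩
    cls A (πH g' ⊕ πH' g')   ≡⟨ cong (cls A) (πH⊕πH' g') ⟨
    cls A g'                 ∎
    where open ≡-Reasoning

  splitting : CayleyIsoTensor A (G/_ {A = A} H H-grp) (_/1 {A = A} H H-grp)
  splitting = record
    { f       = λ g → g , πH g
    ; f-in    = λ g → refl , πH∈H g
    ; f-hom   = λ g g' → H.≈-refl (g ⊕ g') , ≡e⇒Trivial _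
        (trans (cong (πH (g ⊕ g') ⊖_) (sym (πH-⊕ g g'))) (x⊖x≡e (πH (g ⊕ g'))))
    ; f-inj   = injective
    ; f-surj  = surjective
    ; f-basic = λ g g' →
        (λ g~g' → cls⇒SameBasic G/H g g' g~g' , cls⇒SameBasic H/1 (πH g) (πH g') (cls-πH g g' g~g')) ,
        (λ same-G/H same-H/1 → cls-from-πH g g' (SameBasic⇒L≡ G/H g g' same-G/H)
          (SameBasic-/1⇒cls H H-grp (πH g) (πH g') same-H/1))
    }
    where
    G/H = G/_ {A = A} H H-grp
    H/1 = _/1 {A = A} H H-grp

    injective : ∀ g g' → H (g ⊖ g') ≡ true → Trivial (πH g ⊖ πH g') ≡ true → g ≡ g'
    injective g g' g≈g' πHg≈πHg' = begin
      g                ≡⟨ πH⊕πH' g ⟩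
      πH g ⊕ πH' g     ≡⟨ cong₂ _⊕_ πHg≡πHg' (πH'-coset g g' g≈g') ⟩
      πH g' ⊕ πH' g'   ≡⟨ πH⊕πH' g' ⟨
      g'               ∎
      where
      open ≡-Reasoning
      πHg≡πHg' = x⊖y≡e⇒x≡y (πH g) (πH g') (Trivial⇒≡e _ πHg≈πHg')

    surjective : ∀ x v → Full x ≡ true → H v ≡ true →
      Σ (Cyc m) λ g → H (g ⊖ x) ≡ true × Trivial (πH g ⊖ v) ≡ true
    surjective x v _ v∈H =
      v ⊕ πH' x , v⊕πH'x≈x , ≡e⇒Trivial _ (trans (cong (_⊖ v) πH[v⊕πH'x]≡v) (x⊖x≡e v))
      where
      πH[v⊕πH'x]≡v : πH (v ⊕ πH' x) ≡ v
      πH[v⊕πH'x]≡v = proj₁ (πH-unique (v ⊕ πH' x) v (πH' x) v∈H (πH'∈H' x) refl)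
      v⊕πH'x≈x : H ((v ⊕ πH' x) ⊖ x) ≡ true
      v⊕πH'x≈x = subst (λ z → H ((v ⊕ πH' x) ⊖ z) ≡ true) (sym (πH⊕πH' x))
        (H.≈-⊕ v (πH x) (πH' x) (πH' x) (H.⊖-closed v (πH x) v∈H (πH∈H x)) (H.≈-refl (πH' x)))

CayleyIsoTensor-transport : ∀ {m} {A : SRing m} {S S' T T' : Section A} →
  CayleyIsoTensor A S T → SectionIso S S' → SectionIso T T' → CayleyIsoTensor A S' T'
CayleyIsoTensor-transport {A = A} φ σ τ = record
  { f       = λ g → proj₁ (σ-image g) , proj₁ (τ-image g)
  ; f-in    = λ g → proj₂ (R⇒U σ (σ-rel g)) , proj₂ (R⇒U τ (τ-rel g))
  ; f-hom   = λ g g' →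
      ≈-preserved σ (σ-rel (g ⊕ g')) (⊕-preserved σ (σ-rel g) (σ-rel g')) (proj₁ (Φ.f-hom g g')) ,
      ≈-preserved τ (τ-rel (g ⊕ g')) (⊕-preserved τ (τ-rel g) (τ-rel g')) (proj₂ (Φ.f-hom g g'))
  ; f-inj   = λ g g' σg≈σg' τg≈τg' → Φ.f-inj g g'
      (≈-reflected σ (σ-rel g) (σ-rel g') σg≈σg') (≈-reflected τ (τ-rel g) (τ-rel g') τg≈τg')
  ; f-surj  = λ u v u∈U v∈U →
      let (x , rx) = surjective σ u u∈U
          (y , ry) = surjective τ v v∈U
          (g , fg≈x , fg≈y) = Φ.f-surj x y (proj₁ (R⇒U σ rx)) (proj₁ (R⇒U τ ry))
      in g , ≈-preserved σ (σ-rel g) rx fg≈x , ≈-preserved τ (τ-rel g) ry fg≈y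
  ; f-basic = λ g g' →
      (λ g~g' → let (sameS , sameT) = proj₁ (Φ.f-basic g g') g~g' in
        basic-preserved σ (σ-rel g) (σ-rel g') sameS , basic-preserved τ (τ-rel g) (τ-rel g') sameT) ,
      (λ sameS' sameT' → proj₂ (Φ.f-basic g g')
        (basic-reflected σ (σ-rel g) (σ-rel g') sameS') (basic-reflected τ (τ-rel g) (τ-rel g') sameT'))
  }
  where
  module Φ = CayleyIsoTensor φ
  open SectionIso
  σ-image = λ g → total σ (proj₁ (Φ.f g)) (proj₁ (Φ.f-in g))
  τ-image = λ g → total τ (proj₂ (Φ.f g)) (proj₂ (Φ.f-in g))
  σ-rel = λ g → proj₂ (σ-image g)
  τ-rel = λ g → proj₂ (τ-image g)

corollary7p2 : (m : ℕ) (A : SRing m) (H : Subset m) (Hg : IsAGroup A H) →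
    Σ (Subset m) (λ H' → IsAComplement A H H') →
    (S : Section A) → ProjEq S (G/_ {A = A} H Hg) → order≡ S 2 →
    (T : Section A) → ProjEq T (_/1 {A = A} H Hg) →
    CayleyIsoTensor A S T
corollary7p2 m A H Hg (H' , complement) S S∼G/H |S|≡2 T T∼H/1 =
  CayleyIsoTensor-transport (Splitting.splitting Hg complement G/H-index)
    G/H≅S (SectionIso-sym (ProjEq⇒SectionIso T∼H/1))
  where
  G/H≅S : SectionIso (G/_ {A = A} H Hg) S
  G/H≅S = SectionIso-sym (ProjEq⇒SectionIso S∼G/H)
  G/H-index : IndexAtMostTwo (G/_ {A = A} H Hg)
  G/H-index = IndexAtMostTwo-transport G/H≅S (order≡2⇒IndexAtMostTwo S |S|≡2)
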